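{- Let $t\ge 1$ and let $G_t$ be the graph whose vertices are the vectors $x\in\{1,-1\}^{4t}$ orthogonal to each of $r_1=(1,\dots,1)$, $r_2=(1^{(2t)},(-1)^{(2t)})$ and $r_3=(1^{(t)},(-1)^{(t)},1^{(t)},(-1)^{(t)})$ (where $a^{(m)}$ denotes $m$ consecutive entries equal to $a$), adjacency being orthogonality. Then the number of vertices of $G_t$ is $|G_t|=\sum_{k=0}^{t}\binom{t}{k}^4$. -}

module Defs where

open import Data.Nat using (ℕ; _+_; _*_; _^_)
open import Data.Integer using (ℤ; +_; -_) renaming (_+_ to _+ℤ_; _*_ to _*ℤ_)
open import Data.Vec as Vec using (Vec; replicate; _++_; zipWith; foldr)
open import Data.Product using (Σ; _×_; _,_)
open import Data.List using (List; map; upTo)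
open import Data.Nat.ListAction using (sum)
open import Data.Nat.Combinatorics using (_C_)
open import Relation.Binary.PropositionalEquality using (_≡_)
open import Data.Sum using (_⊎_)

rep : (m : ℕ) → ℤ → Vec ℤ m
rep m a = replicate m a

dot : ∀ {n} → Vec ℤ n → Vec ℤ n → ℤ
dot u v = foldr _ _+ℤ_ (+ 0) (zipWith _*ℤ_ u v)

data IsSign : ℤ → Set where
  plus  : IsSign (+ 1)
  minus : IsSign (- (+ 1))

data AllSigns : ∀ {n} → Vec ℤ n → Set where
  []  : AllSigns Vec.[]
  _∷_ : ∀ {n a} {v : Vec ℤ n} → IsSign a → AllSigns v → AllSigns (a Vec.∷ v)

len : ℕ → ℕ
len t = t + (t + (t + t))

r₁ : (t : ℕ) → Vec ℤ (len t)
r₁ t = rep t (+ 1) ++ rep t (+ 1) ++ rep t (+ 1) ++ rep t (+ 1)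

r₂ : (t : ℕ) → Vec ℤ (len t)
r₂ t = rep t (+ 1) ++ rep t (+ 1) ++ rep t (- (+ 1)) ++ rep t (- (+ 1))

r₃ : (t : ℕ) → Vec ℤ (len t)
r₃ t = rep t (+ 1) ++ rep t (- (+ 1)) ++ rep t (+ 1) ++ rep t (- (+ 1))

IsVertex : (t : ℕ) → Vec ℤ (len t) → Set
IsVertex t x = AllSigns x × dot x (r₁ t) ≡ + 0 × dot x (r₂ t) ≡ + 0 × dot x (r₃ t) ≡ + 0

V : ℕ → Set
V t = Σ (Vec ℤ (len t)) (IsVertex t)

-- adjacency (orthogonality); not needed for the vertex count
Adj : (t : ℕ) → V t → V t → Set
Adj t (x , _) (y , _) = dot x y ≡ + 0

countFormula : ℕ → ℕ
countFormula t = sum (map (λ k → (t C k) ^ 4) (upTo (1 + t)))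

-- Cut x
-- into four blocks a, b, c, d of length t with A, B, C, D plus signs; a
-- block with p plus signs has entry sum 2p − t.  The dot products with
-- r₁, r₂, r₃ are signed sums of the four block sums, and the resulting
-- linear system forces  sum b = sum c = − sum a  and  sum d = sum a, i.e.
--     B = t − A,   C = t − A,   D = A.
-- Grouping the vertices by k = A, the k-th group is a product of four
-- sets of sign vectors with k, t − k, t − k and k plus signs, each of
-- size (t choose k); summing over 0 ≤ k ≤ t gives the formula.
module Submission where

open import Defs
open import Data.Nat using (ℕ; zero; suc; _≤_; _<_; _≥_; z≤n; s≤s; s≤s⁻¹; _∸_; _^_)
  renaming (_+_ to _+ℕ_)
import Data.Nat.Properties as ℕP
open import Data.Nat.Combinatorics using (_C_; nCk+nC[k+1]≡[n+1]C[k+1]; nCk≡nC[n∸k])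
open import Data.Nat.ListAction using (sum)
open import Data.Integer using (ℤ; +_; -_; _-_) renaming (_+_ to _+ℤ_; _*_ to _*ℤ_)
import Data.Integer.Properties as ℤP
open import Data.Integer.Tactic.RingSolver using (solve-∀)
open import Data.Fin using (Fin; zero)
import Data.Fin.Properties as FinP
open import Data.Vec using (Vec; []; _∷_; _++_)
open import Data.List using (applyUpTo)
open import Data.List.Properties using (map-upTo)
open import Data.Product using (Σ; _×_; _,_; proj₁; map₁; uncurry)
open import Data.Product.Function.NonDependent.Propositional using (_×-↔_)
open import Data.Product.Function.Dependent.Propositional using (Σ-↔)
open import Data.Sum using (_⊎_; inj₁; inj₂)
open import Data.Sum.Function.Propositional using (_⊎-↔_)
open import Data.Empty using (⊥-elim)
open import Function using (_∘_; id)
open import Function.Bundles using (_↔_; _⇔_; mk↔ₛ′; mk⇔; Inverse; Equivalence)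
open import Function.Properties.Inverse using (↔-refl; ↔-sym; ↔-trans)
open import Function.Construct.Composition using (_⇔-∘_)
open import Function.Construct.Symmetry using (⇔-sym)
open import Function.Related.Propositional using (module EquationalReasoning)
open import Relation.Nullary using (¬_)
open import Relation.Nullary.Irrelevant using (Irrelevant)
open import Relation.Binary.PropositionalEquality

Fin-cong : ∀ {m n} → m ≡ n → Fin m ↔ Fin n
Fin-cong refl = ↔-refl

⇔⇒↔ : {P Q : Set} → Irrelevant P → Irrelevant Q → P ⇔ Q → P ↔ Q
⇔⇒↔ P-irr Q-irr P⇔Q =
  mk↔ₛ′ to from (λ q → Q-irr (to (from q)) q) (λ p → P-irr (from (to p)) p)
  where open Equivalence P⇔Q

≡³-irrelevant : {A B C : Set} {a a′ : A} {b b′ : B} {c c′ : C} →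
                Irrelevant (a ≡ a′ × b ≡ b′ × c ≡ c′)
≡³-irrelevant (refl , refl , refl) (refl , refl , refl) = refl

Σ-fibres : {A B : Set} (f : A → B) (G : B → Set) →
           Σ A (G ∘ f) ↔ Σ B (λ b → Σ A (λ a → f a ≡ b) × G b)
Σ-fibres {A} {B} f G = mk↔ₛ′ to from (λ { (_ , (_ , refl) , _) → refl }) (λ _ → refl)
  where
  to : Σ A (G ∘ f) → Σ B (λ b → Σ A (λ a → f a ≡ b) × G b)
  to (a , g) = f a , (a , refl) , g
  from : Σ B (λ b → Σ A (λ a → f a ≡ b) × G b) → Σ A (G ∘ f)
  from (_ , (a , refl) , g) = a , g

Σℕ-uncons : (H : ℕ → Set) → Σ ℕ H ↔ (H 0 ⊎ Σ ℕ (H ∘ suc))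
Σℕ-uncons H = mk↔ₛ′
  (λ { (zero , h) → inj₁ h ; (suc j , h) → inj₂ (j , h) })
  (λ { (inj₁ h) → zero , h ; (inj₂ (j , h)) → suc j , h })
  (λ { (inj₁ _) → refl ; (inj₂ _) → refl })
  (λ { (zero , _) → refl ; (suc _ , _) → refl })

Σℕ-count : ∀ m (H : ℕ → Set) (h : ℕ → ℕ) →
           (∀ j → j < m → H j ↔ Fin (h j)) → (∀ j → m ≤ j → ¬ H j) →
           Σ ℕ H ↔ Fin (sum (applyUpTo h m))
Σℕ-count zero H h _ empty = mk↔ₛ′
  (λ (j , x) → ⊥-elim (empty j z≤n x)) (λ ()) (λ ()) (λ (j , x) → ⊥-elim (empty j z≤n x))
Σℕ-count (suc m) H h size empty =
  ↔-trans (Σℕ-uncons H)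
    (↔-trans (size 0 (s≤s z≤n) ⊎-↔ rest) (↔-sym FinP.+↔⊎))
  where
  rest : Σ ℕ (H ∘ suc) ↔ Fin (sum (applyUpTo (h ∘ suc) m))
  rest = Σℕ-count m (H ∘ suc) (h ∘ suc) (λ j → size (suc j) ∘ s≤s) (λ j → empty (suc j) ∘ s≤s)

Fin⁴ : ∀ c → (Fin c × Fin c × Fin c × Fin c) ↔ Fin (c ^ 4)
Fin⁴ c =
  ↔-trans (↔-refl ×-↔ (↔-refl ×-↔ (↔-refl ×-↔ Fin-cong (sym (ℕP.*-identityʳ c)))))
  (↔-trans (↔-refl ×-↔ (↔-refl ×-↔ ↔-sym FinP.*↔×))
  (↔-trans (↔-refl ×-↔ ↔-sym FinP.*↔×) (↔-sym FinP.*↔×)))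

SignVec : ℕ → Set
SignVec n = Σ (Vec ℤ n) AllSigns

_∷ˢ_ : ∀ {n a} → IsSign a → SignVec n → SignVec (suc n)
_∷ˢ_ {a = a} σ (x , s) = a ∷ x , σ ∷ s

#plus : ∀ {n} → SignVec n → ℕ
#plus (_ , []) = zero
#plus (_ ∷ x , plus ∷ s) = suc (#plus (x , s))
#plus (_ ∷ x , minus ∷ s) = #plus (x , s)

#plus≤length : ∀ {n} (v : SignVec n) → #plus v ≤ n
#plus≤length (_ , []) = z≤n
#plus≤length (_ ∷ x , plus ∷ s) = s≤s (#plus≤length (x , s))
#plus≤length (_ ∷ x , minus ∷ s) = ℕP.m≤n⇒m≤1+n (#plus≤length (x , s))

allSigns-++ : ∀ {m n} {x : Vec ℤ m} {y : Vec ℤ n} → AllSigns x → AllSigns y → AllSigns (x ++ y)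
allSigns-++ [] r = r
allSigns-++ (σ ∷ s) r = σ ∷ allSigns-++ s r

_++ˢ_ : ∀ {m n} → SignVec m → SignVec n → SignVec (m +ℕ n)
(x , s) ++ˢ (y , r) = x ++ y , allSigns-++ s r

splitˢ : ∀ m {n} → SignVec (m +ℕ n) → SignVec m × SignVec n
splitˢ zero v = ([] , []) , v
splitˢ (suc m) (_ ∷ x , σ ∷ s) = map₁ (σ ∷ˢ_) (splitˢ m (x , s))

++ˢ-↔ : ∀ m n → (SignVec m × SignVec n) ↔ SignVec (m +ℕ n)
++ˢ-↔ m n = mk↔ₛ′ (uncurry _++ˢ_) (splitˢ m) (join-split m) (split-join m)
  where
  join-split : ∀ k (v : SignVec (k +ℕ n)) → uncurry _++ˢ_ (splitˢ k v) ≡ v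
  join-split zero v = refl
  join-split (suc k) (_ ∷ x , σ ∷ s) = cong (σ ∷ˢ_) (join-split k (x , s))
  split-join : ∀ k (p : SignVec k × SignVec n) → splitˢ k (uncurry _++ˢ_ p) ≡ p
  split-join zero (([] , []) , w) = refl
  split-join (suc k) ((_ ∷ x , σ ∷ s) , w) = cong (map₁ (σ ∷ˢ_)) (split-join k ((x , s) , w))

blocks : ∀ t → (SignVec t × SignVec t × SignVec t × SignVec t) ↔ SignVec (len t)
blocks t =
  ↔-trans (↔-refl ×-↔ (↔-refl ×-↔ ++ˢ-↔ t t))
  (↔-trans (↔-refl ×-↔ ++ˢ-↔ t (t +ℕ t)) (++ˢ-↔ t (t +ℕ (t +ℕ t))))

WithPluses : ℕ → ℕ → Set
WithPluses n k = Σ (SignVec n) (λ v → #plus v ≡ k)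

drop-minus : ∀ {n} → WithPluses (suc n) zero ↔ WithPluses n zero
drop-minus = mk↔ₛ′
  (λ { ((_ ∷ x , minus ∷ s) , e) → (x , s) , e ; ((_ ∷ _ , plus ∷ _) , ()) })
  (λ (v , e) → (minus ∷ˢ v) , e)
  (λ _ → refl)
  (λ { ((_ ∷ _ , minus ∷ _) , _) → refl ; ((_ ∷ _ , plus ∷ _) , ()) })

-- Pascal's rule: the first sign is + (k plus signs remain) or − (k + 1 remain).
split-first : ∀ {n k} → WithPluses (suc n) (suc k) ↔ (WithPluses n k ⊎ WithPluses n (suc k))
split-first {n} = mk↔ₛ′ to from to∘from from∘to
  where
  to : ∀ {k} → WithPluses (suc n) (suc k) → WithPluses n k ⊎ WithPluses n (suc k)
  to ((_ ∷ x , plus ∷ s) , refl) = inj₁ ((x , s) , refl)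
  to ((_ ∷ x , minus ∷ s) , e) = inj₂ ((x , s) , e)
  from : ∀ {k} → WithPluses n k ⊎ WithPluses n (suc k) → WithPluses (suc n) (suc k)
  from (inj₁ (v , refl)) = (plus ∷ˢ v) , refl
  from (inj₂ (v , e)) = (minus ∷ˢ v) , e
  to∘from : ∀ {k} (y : WithPluses n k ⊎ WithPluses n (suc k)) → to (from y) ≡ y
  to∘from (inj₁ (_ , refl)) = refl
  to∘from (inj₂ _) = refl
  from∘to : ∀ {k} (x : WithPluses (suc n) (suc k)) → from (to x) ≡ x
  from∘to ((_ ∷ _ , plus ∷ _) , refl) = refl
  from∘to ((_ ∷ _ , minus ∷ _) , _) = refl

WithPluses-count : ∀ n k → WithPluses n k ↔ Fin (n C k)
WithPluses-count zero zero = mk↔ₛ′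
  (λ _ → zero) (λ _ → ([] , []) , refl) (λ { zero → refl }) (λ { (([] , []) , refl) → refl })
WithPluses-count zero (suc k) = mk↔ₛ′
  (λ { (([] , []) , ()) }) (λ ()) (λ ()) (λ { (([] , []) , ()) })
WithPluses-count (suc n) zero = ↔-trans drop-minus (WithPluses-count n zero)
WithPluses-count (suc n) (suc k) =
  ↔-trans split-first
  (↔-trans (WithPluses-count n k ⊎-↔ WithPluses-count n (suc k))
  (↔-trans (↔-sym FinP.+↔⊎) (Fin-cong (nCk+nC[k+1]≡[n+1]C[k+1] n k))))

dot-++ : ∀ {m n} (u : Vec ℤ m) (v : Vec ℤ n) (p : Vec ℤ m) (q : Vec ℤ n) →
         dot (u ++ v) (p ++ q) ≡ dot u p +ℤ dot v q
dot-++ [] v [] q = sym (ℤP.+-identityˡ (dot v q))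
dot-++ (a ∷ u) v (b ∷ p) q =
  trans (cong (a *ℤ b +ℤ_) (dot-++ u v p q)) (sym (ℤP.+-assoc (a *ℤ b) (dot u p) (dot v q)))

dot-blocks : ∀ {t} (a b c d p q r s : Vec ℤ t) →
             dot (a ++ (b ++ (c ++ d))) (p ++ (q ++ (r ++ s)))
               ≡ dot a p +ℤ (dot b q +ℤ (dot c r +ℤ dot d s))
dot-blocks a b c d p q r s = begin
  dot (a ++ (b ++ (c ++ d))) (p ++ (q ++ (r ++ s)))  ≡⟨ dot-++ a _ p _ ⟩
  dot a p +ℤ dot (b ++ (c ++ d)) (q ++ (r ++ s))      ≡⟨ cong (dot a p +ℤ_) (dot-++ b _ q _) ⟩
  dot a p +ℤ (dot b q +ℤ dot (c ++ d) (r ++ s))       ≡⟨ cong (λ z → dot a p +ℤ (dot b q +ℤ z)) (dot-++ c d r s) ⟩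
  dot a p +ℤ (dot b q +ℤ (dot c r +ℤ dot d s))        ∎
  where open ≡-Reasoning

dot-rep-neg : ∀ {n} (x : Vec ℤ n) (a : ℤ) → dot x (rep n (- a)) ≡ - dot x (rep n a)
dot-rep-neg [] a = refl
dot-rep-neg {suc n} (b ∷ x) a =
  trans (cong (b *ℤ - a +ℤ_) (dot-rep-neg x a)) (neg-step b a (dot x (rep n a)))
  where
  neg-step : ∀ b a D → b *ℤ - a +ℤ - D ≡ - (b *ℤ a +ℤ D)
  neg-step = solve-∀

total : ∀ {n} → Vec ℤ n → ℤ
total {n} x = dot x (rep n (+ 1))

signTotal : ℕ → ℕ → ℤ
signTotal n p = + 2 *ℤ + p - + n

total-signs : ∀ {n} (v : SignVec n) → total (proj₁ v) ≡ signTotal n (#plus v)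
total-signs (_ , []) = refl
total-signs {suc n} (_ ∷ x , plus ∷ s) =
  trans (cong (+ 1 +ℤ_) (total-signs (x , s))) (plus-step (+ #plus (x , s)) (+ n))
  where
  plus-step : ∀ p n → + 1 +ℤ (+ 2 *ℤ p - n) ≡ + 2 *ℤ (+ 1 +ℤ p) - (+ 1 +ℤ n)
  plus-step = solve-∀
total-signs {suc n} (_ ∷ x , minus ∷ s) =
  trans (cong (- + 1 +ℤ_) (total-signs (x , s))) (minus-step (+ #plus (x , s)) (+ n))
  where
  minus-step : ∀ p n → - + 1 +ℤ (+ 2 *ℤ p - n) ≡ + 2 *ℤ p - (+ 1 +ℤ n)
  minus-step = solve-∀

signTotal-injective : ∀ {n p q} → signTotal n p ≡ signTotal n q → p ≡ q
signTotal-injective {n} {p} {q} eq = ℤP.+-injective (ℤP.*-cancelˡ-≡ (+ 2) (+ p) (+ q) (begin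
  + 2 *ℤ + p              ≡⟨ restore (+ 2 *ℤ + p) (+ n) ⟩
  signTotal n p +ℤ + n    ≡⟨ cong (_+ℤ + n) eq ⟩
  signTotal n q +ℤ + n    ≡⟨ restore (+ 2 *ℤ + q) (+ n) ⟨
  + 2 *ℤ + q              ∎))
  where
  open ≡-Reasoning
  restore : ∀ x y → x ≡ (x - y) +ℤ y
  restore = solve-∀

-- Flipping every sign of a vector with p plus signs leaves n − p plus signs.
signTotal-neg : ∀ {n p} → p ≤ n → - signTotal n p ≡ signTotal n (n ∸ p)
signTotal-neg {p = p} p≤n with ℕP.m≤n⇒∃[o]m+o≡n p≤n
... | m , refl = begin
  - signTotal (p +ℕ m) p          ≡⟨ flip-step (+ p) (+ m) ⟩
  signTotal (p +ℕ m) m            ≡⟨ cong (signTotal (p +ℕ m)) (ℕP.m+n∸m≡n p m) ⟨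
  signTotal (p +ℕ m) (p +ℕ m ∸ p)  ∎
  where
  open ≡-Reasoning
  flip-step : ∀ p m → - (+ 2 *ℤ p - (p +ℤ m)) ≡ + 2 *ℤ m - (p +ℤ m)
  flip-step = solve-∀

Orthogonal : (t : ℕ) → Vec ℤ (len t) → Set
Orthogonal t x = dot x (r₁ t) ≡ + 0 × dot x (r₂ t) ≡ + 0 × dot x (r₃ t) ≡ + 0

System : ℤ → ℤ → ℤ → ℤ → Set
System α β γ δ = α +ℤ (β +ℤ (γ +ℤ δ)) ≡ + 0
               × α +ℤ (β +ℤ (- γ +ℤ - δ)) ≡ + 0
               × α +ℤ (- β +ℤ (γ +ℤ - δ)) ≡ + 0

equations-cong : ∀ {x₁ x₂ x₃ y₁ y₂ y₃ : ℤ} → x₁ ≡ y₁ → x₂ ≡ y₂ → x₃ ≡ y₃ →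
  (x₁ ≡ + 0 × x₂ ≡ + 0 × x₃ ≡ + 0) ⇔ (y₁ ≡ + 0 × y₂ ≡ + 0 × y₃ ≡ + 0)
equations-cong refl refl refl = mk⇔ id id

orthogonal⇔system : ∀ {t} (a b c d : Vec ℤ t) →
  Orthogonal t (a ++ (b ++ (c ++ d))) ⇔ System (total a) (total b) (total c) (total d)
orthogonal⇔system {t} a b c d = equations-cong
  (dot-blocks a b c d one one one one)
  (trans (dot-blocks a b c d one one neg neg)
         (cong₂ (λ u w → total a +ℤ (total b +ℤ (u +ℤ w))) (dot-rep-neg c (+ 1)) (dot-rep-neg d (+ 1))))
  (trans (dot-blocks a b c d one neg one neg)
         (cong₂ (λ u w → total a +ℤ (u +ℤ (total c +ℤ w))) (dot-rep-neg b (+ 1)) (dot-rep-neg d (+ 1))))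
  where
  one neg : Vec ℤ t
  one = rep t (+ 1)
  neg = rep t (- + 1)

halve : ∀ x y e → + 2 *ℤ x ≡ + 2 *ℤ y +ℤ e → e ≡ + 0 → x ≡ y
halve x y e eq refl = ℤP.*-cancelˡ-≡ (+ 2) x y (trans eq (ℤP.+-identityʳ (+ 2 *ℤ y)))

system-solution : ∀ α β γ δ → System α β γ δ ⇔ (β ≡ - α × γ ≡ - α × δ ≡ α)
system-solution α β γ δ = mk⇔
  (λ (e₁ , e₂ , e₃) →
     halve β (- α) _ (β-eq α β γ δ) (cong₂ _+ℤ_ e₁ e₂) ,
     halve γ (- α) _ (γ-eq α β γ δ) (cong₂ _+ℤ_ e₁ e₃) ,
     halve δ α _ (δ-eq α β γ δ) (cong (-_) (cong₂ _+ℤ_ e₂ e₃)))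
  (λ { (refl , refl , refl) → r₁-sol α , r₂-sol α , r₃-sol α })
  where
  β-eq : ∀ α β γ δ → + 2 *ℤ β ≡ + 2 *ℤ (- α) +ℤ ((α +ℤ (β +ℤ (γ +ℤ δ))) +ℤ (α +ℤ (β +ℤ (- γ +ℤ - δ))))
  β-eq = solve-∀
  γ-eq : ∀ α β γ δ → + 2 *ℤ γ ≡ + 2 *ℤ (- α) +ℤ ((α +ℤ (β +ℤ (γ +ℤ δ))) +ℤ (α +ℤ (- β +ℤ (γ +ℤ - δ))))
  γ-eq = solve-∀
  δ-eq : ∀ α β γ δ → + 2 *ℤ δ ≡ + 2 *ℤ α +ℤ - ((α +ℤ (β +ℤ (- γ +ℤ - δ))) +ℤ (α +ℤ (- β +ℤ (γ +ℤ - δ))))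
  δ-eq = solve-∀
  r₁-sol : ∀ α → α +ℤ (- α +ℤ (- α +ℤ α)) ≡ + 0
  r₁-sol = solve-∀
  r₂-sol : ∀ α → α +ℤ (- α +ℤ (- - α +ℤ - α)) ≡ + 0
  r₂-sol = solve-∀
  r₃-sol : ∀ α → α +ℤ (- - α +ℤ (- α +ℤ - α)) ≡ + 0
  r₃-sol = solve-∀

Quad : ℕ → Set
Quad t = SignVec t × SignVec t × SignVec t × SignVec t

Balanced : (t : ℕ) → Quad t → Set
Balanced t (a , b , c , d) = #plus b ≡ t ∸ #plus a × #plus c ≡ t ∸ #plus a × #plus d ≡ #plus a

-- For sign blocks, the solved system says exactly that the blocks are balanced:
-- rewrite each block total as 2·(plus count) − t and compare plus counts.
solved⇔balanced : ∀ {t} (a b c d : SignVec t) →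
  (total (proj₁ b) ≡ - total (proj₁ a) × total (proj₁ c) ≡ - total (proj₁ a) × total (proj₁ d) ≡ total (proj₁ a))
  ⇔ Balanced t (a , b , c , d)
solved⇔balanced {t} a b c d
  rewrite total-signs a | total-signs b | total-signs c | total-signs d = mk⇔
  (λ (eb , ec , ed) → opposite eb , opposite ec , signTotal-injective ed)
  (λ (eb , ec , ed) → opposite⁻¹ eb , opposite⁻¹ ec , cong (signTotal t) ed)
  where
  complement : - signTotal t (#plus a) ≡ signTotal t (t ∸ #plus a)
  complement = signTotal-neg (#plus≤length a)
  opposite : ∀ {X} → signTotal t X ≡ - signTotal t (#plus a) → X ≡ t ∸ #plus a
  opposite e = signTotal-injective (trans e complement)
  opposite⁻¹ : ∀ {X} → X ≡ t ∸ #plus a → signTotal t X ≡ - signTotal t (#plus a)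
  opposite⁻¹ e = trans (cong (signTotal t) e) (sym complement)

orthogonal⇔balanced : ∀ {t} (q : Quad t) → Orthogonal t (proj₁ (Inverse.to (blocks t) q)) ⇔ Balanced t q
orthogonal⇔balanced (a , b , c , d) =
  solved⇔balanced a b c d ⇔-∘ (system-solution _ _ _ _ ⇔-∘ orthogonal⇔system (proj₁ a) (proj₁ b) (proj₁ c) (proj₁ d))

vertices≅orthogonal : ∀ t → V t ↔ Σ (SignVec (len t)) (Orthogonal t ∘ proj₁)
vertices≅orthogonal t = mk↔ₛ′
  (λ (x , s , o) → (x , s) , o) (λ ((x , s) , o) → x , s , o) (λ _ → refl) (λ _ → refl)

balanced≅orthogonal : ∀ t → Σ (Quad t) (Balanced t) ↔ Σ (SignVec (len t)) (Orthogonal t ∘ proj₁)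
balanced≅orthogonal t = Σ-↔ (blocks t)
  (λ {q} → ⇔⇒↔ ≡³-irrelevant ≡³-irrelevant (⇔-sym (orthogonal⇔balanced q)))

Partners : ℕ → ℕ → Set
Partners t j = WithPluses t (t ∸ j) × WithPluses t (t ∸ j) × WithPluses t j

balanced≅partners : ∀ t → Σ (Quad t) (Balanced t) ↔ Σ (SignVec t) (Partners t ∘ #plus)
balanced≅partners t = mk↔ₛ′
  (λ ((a , b , c , d) , eb , ec , ed) → a , (b , eb) , (c , ec) , (d , ed))
  (λ (a , (b , eb) , (c , ec) , (d , ed)) → (a , b , c , d) , eb , ec , ed)
  (λ _ → refl) (λ _ → refl)

Layer : ℕ → ℕ → Set
Layer t j = WithPluses t j × Partners t j

layer-count : ∀ {t j} → j ≤ t → Layer t j ↔ Fin ((t C j) ^ 4)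
layer-count {t} {j} j≤t =
  ↔-trans (WithPluses-count t j ×-↔ (complement ×-↔ (complement ×-↔ WithPluses-count t j)))
          (Fin⁴ (t C j))
  where
  complement : WithPluses t (t ∸ j) ↔ Fin (t C j)
  complement = ↔-trans (WithPluses-count t (t ∸ j)) (Fin-cong (sym (nCk≡nC[n∸k] j≤t)))

layer-empty : ∀ {t j} → t < j → ¬ Layer t j
layer-empty t<j ((a , e) , _) = ℕP.<⇒≱ t<j (subst (_≤ _) e (#plus≤length a))

lemma2 : (t : ℕ) → t ≥ 1 → V t ↔ Fin (countFormula t)
lemma2 t _ = begin
  V t                                              ↔⟨ vertices≅orthogonal t ⟩
  Σ (SignVec (len t)) (Orthogonal t ∘ proj₁)        ↔⟨ balanced≅orthogonal t ⟨
  Σ (Quad t) (Balanced t)                           ↔⟨ balanced≅partners t ⟩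
  Σ (SignVec t) (Partners t ∘ #plus)                ↔⟨ Σ-fibres #plus (Partners t) ⟩
  Σ ℕ (Layer t)                                     ↔⟨ Σℕ-count (suc t) (Layer t) fourthPower
                                                         (λ _ → layer-count ∘ s≤s⁻¹) (λ _ → layer-empty) ⟩
  Fin (sum (applyUpTo fourthPower (suc t)))          ↔⟨ Fin-cong (cong sum (map-upTo fourthPower (suc t))) ⟨
  Fin (countFormula t)                              ∎
  where
  open EquationalReasoning
  fourthPower : ℕ → ℕ
  fourthPower j = (t C j) ^ 4
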